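{- Let $m,n\geq 1$ and let $P\in\mathrm{Polyo}_{m,n}$ have upper path with steps $u_1u_2\cdots u_{m+n}$ and lower path with steps $\ell_1\ell_2\cdots \ell_{m+n}$ (each step $N$ or $E$). Let $D=\mathsf{ptd}(P)$ be the lattice path with $2(m+n)$ steps, each a rise (Northeast step) or a fall (Southeast step), whose $(2i-1)$-th step is a rise if $u_i=N$ and a fall if $u_i=E$, and whose $2i$-th step is a rise if $\ell_i=E$ and a fall if $\ell_i=N$, for $i=1,\dots,m+n$. (Then $D$ is a Dyck path, starting at height $0$.) Label the horizontal rows of $D$ from bottom to top by $\overline{0},1,\overline{1},2,\overline{2},3,\overline{3},\dots$, i.e. the row between heights $h$ and $h+1$ gets the $(h+1)$-th label in this list. Then the word obtained by reading, from left to right, the labels of the rows in which the rises of $D$ lie is exactly the area word of $P$.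
   Context: A parallelogram polyomino with an $m\times n$ bounding box is a pair of lattice paths (an upper path and a lower path) from $(0,0)$ to $(m,n)$ using unit North ($N$) and East ($E$) steps, which meet only at their starting and ending points, the upper path lying weakly above/left of the lower one (so the upper path starts with $N$ and the lower with $E$). $\mathrm{Polyo}_{m,n}$ denotes the set of these. The interior is the region between the two paths; its unit squares are the squares of the polyomino. Area word: first, for each East step of the lower path, draw from its East endpoint a line in the Northwest direction (slope $-1$) until it reaches the upper path, and label this East step with the (unbarred) number of squares crossed by this line. Second, label each North step of the upper path with the barred number $\overline{k}$, where $k$ is the number of interior squares in the row immediately to the East of that step which were not crossed by any of the lines drawn in the first stage. The area word is obtained by reading these labels in the order in which a line of slope $-1$ sweeping from the Southwest corner to the Northeast corner meets the labelled steps (i.e. in increasing order of $x+y$ of the starting point of the step), writing the label of the upper-path step first when an upper North step and a lower East step are met simultaneously. The word has $m+n$ letters. -}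

module Defs where

open import Data.Nat using (ℕ; zero; suc; _+_; _∸_; _≤_; _<_; _≤ᵇ_; _<ᵇ_; _≡ᵇ_)
open import Data.Bool using (Bool; true; false; _∧_; not; if_then_else_)
open import Data.List using (List; []; _∷_; _++_; take; map; concatMap; upTo; filter; length; drop)
open import Data.Product using (_×_; _,_; proj₁; proj₂)
open import Relation.Binary.PropositionalEquality using (_≡_; _≢_)

data Step : Set where
  N E : Step

isN : Step → Bool
isN N = true
isN E = false

isE : Step → Bool
isE s = not (isN s)

countN : List Step → ℕ
countN []       = 0
countN (N ∷ p)  = suc (countN p)
countN (E ∷ p)  = countN p

countE : List Step → ℕ
countE []       = 0
countE (N ∷ p)  = countE p
countE (E ∷ p)  = suc (countE p)

IsPath : ℕ → ℕ → List Step → Set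
IsPath m n p = (countE p ≡ m) × (countN p ≡ n)

point : ℕ → List Step → ℕ × ℕ
point i p = countE (take i p) , countN (take i p)

-- Every vertex of a N/E path on the antidiagonal x+y=i is its i-th point,
-- so "the two paths meet only at their endpoints" says exactly that their
-- i-th points differ for 0 < i < m+n; "upper weakly above lower" says the
-- upper i-th point has at least as large a y-coordinate.

record Polyo (m n : ℕ) : Set where
  field
    upper          : List Step
    lower          : List Step
    upper-path     : IsPath m n upper
    lower-path     : IsPath m n lower
    weakly-above   : ∀ i → countN (take i lower) ≤ countN (take i upper)
    meet-only-ends : ∀ i → 0 < i → i < m + n → point i upper ≢ point i lower

open Polyo public

-- The unit square with lower-left corner (a , b).
-- In column a the interior consists of the squares between the East step
-- of the lower path in that column and the East step of the upper path.

eHeight : List Step → ℕ → ℕ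
eHeight []      a       = 0
eHeight (N ∷ p) a       = suc (eHeight p a)
eHeight (E ∷ p) zero    = 0
eHeight (E ∷ p) (suc a) = eHeight p a

squares : ℕ → ℕ → List (ℕ × ℕ)
squares m n = concatMap (λ a → map (λ b → a , b) (upTo n)) (upTo m)

module _ {m n : ℕ} (P : Polyo m n) where

  interior : ℕ × ℕ → Bool
  interior (a , b) = (eHeight (lower P) a ≤ᵇ b) ∧ (b <ᵇ eHeight (upper P) a)

  countSq : (ℕ × ℕ → Bool) → ℕ
  countSq f = length (filter (λ s → f s Data.Bool.≟ true) (squares m n))

  -- Stage 1.  The lower-path step with 0-based index i ends on the
  -- antidiagonal x+y = i+1; if it is an East step, the NW line drawn from
  -- its endpoint runs along that antidiagonal to the upper path and crosses
  -- (diagonally) exactly the interior squares (a , b) with a+b+1 = i+1.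
  crossedBy : ℕ → ℕ × ℕ → Bool
  crossedBy i (a , b) = interior (a , b) ∧ ((a + b) ≡ᵇ i)

  lowerLabel : ℕ → ℕ
  lowerLabel i = countSq (crossedBy i)

  -- a square is crossed by some drawn line iff it is crossed by the line
  -- on its antidiagonal and that line was drawn (lower step a+b is East)
  stepIsE : List Step → ℕ → Bool
  stepIsE []      _       = false
  stepIsE (s ∷ p) zero    = isE s
  stepIsE (s ∷ p) (suc k) = stepIsE p k

  crossed : ℕ × ℕ → Bool
  crossed (a , b) = interior (a , b) ∧ stepIsE (lower P) (a + b)

  upperLabel : ℕ → ℕ
  upperLabel i = countSq (λ { (a , b) →
      interior (a , b) ∧ (b ≡ᵇ proj₂ (point i (upper P)))
        ∧ (proj₁ (point i (upper P)) ≤ᵇ a) ∧ not (crossed (a , b)) })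

data Letter : Set where
  unbar : ℕ → Letter
  bar   : ℕ → Letter

module _ {m n : ℕ} (P : Polyo m n) where

  -- steps with 0-based index i of both paths start on antidiagonal x+y = i;
  -- the upper label is written first.
  areaWordFrom : ℕ → List Step → List Step → List Letter
  areaWordFrom i (u ∷ us) (l ∷ ls) =
    (if isN u then bar (upperLabel P i) ∷ [] else [])
    ++ (if isE l then unbar (lowerLabel P i) ∷ [] else [])
    ++ areaWordFrom (suc i) us ls
  areaWordFrom i _ _ = []

  areaWord : List Letter
  areaWord = areaWordFrom 0 (upper P) (lower P)

data DStep : Set where
  rise fall : DStep

riseIf : Bool → DStep
riseIf true  = rise
riseIf false = fall

ptdPath : List Step → List Step → List DStep
ptdPath (u ∷ us) (l ∷ ls) = riseIf (isN u) ∷ riseIf (isE l) ∷ ptdPath us ls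
ptdPath _ _ = []

ptd : {m n : ℕ} → Polyo m n → List DStep
ptd P = ptdPath (upper P) (lower P)

incr : Letter → Letter
incr (unbar k) = unbar (suc k)
incr (bar k)   = bar (suc k)

rowLabel : ℕ → Letter
rowLabel zero          = bar 0
rowLabel (suc zero)    = unbar 1
rowLabel (suc (suc h)) = incr (rowLabel h)

riseLabels : ℕ → List DStep → List Letter
riseLabels h []         = []
riseLabels h (rise ∷ d) = rowLabel h ∷ riseLabels (suc h) d
riseLabels h (fall ∷ d) = riseLabels (h ∸ 1) d

-- Let g(i) be the gap between the two paths on the antidiagonal x + y = i: the difference of the
-- heights of their i-th points, equivalently of their x-coordinates.  An upper N step or a lower
-- E step raises the gap by one, the other steps lower it, so after 2i steps ptd P is at height
-- 2 g(i).  Hence an upper N step (a rise from height 2 g(i)) is read as the bar of g(i), and a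
-- lower E step (a rise ending at height 2 g(i+1)) as g(i+1).  The area word carries the same
-- numbers: the line from the end of lower step i crosses one square in each of the g(i+1)
-- columns between the two paths, and of the squares east of an upper N step at height y the
-- uncrossed ones are those whose line is missing because the lower path goes North there, one for
-- each North step it still needs to climb from y - g(i) to y.

module Submission where

open import Defs
open import Data.Bool using (Bool; true; false; T; _∧_; not)
open import Data.Bool.Properties using (T-∧; T-≡; T-not-≡; ∧-zeroʳ; ∧-identityʳ)
open import Data.Empty using (⊥-elim)
open import Data.List using (List; []; _∷_; _++_; take; drop; length; map; filter; concatMap; applyUpTo; upTo)
open import Data.List.Properties using (filter-++; length-++; length-drop; take++drop≡id; take-[])
open import Data.Nat using (ℕ; zero; suc; _+_; _∸_; _≤_; _<_; _≤ᵇ_; _<ᵇ_; _≡ᵇ_; _≤?_; _<?_; z≤n; s≤s; z<s; s<s)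
open import Data.Nat.Properties
open import Data.Product using (_,_; proj₁; proj₂)
open import Data.Unit using (tt)
open import Function using (_∘_)
open import Function.Bundles using (_⇔_; mk⇔; Equivalence)
open import Relation.Nullary using (¬_; yes; no; contradiction)
open import Relation.Binary.PropositionalEquality

open Equivalence using (to; from)

𝟙 : Bool → ℕ
𝟙 true  = 1
𝟙 false = 0

T-injective : ∀ {b c} → T b ⇔ T c → b ≡ c
T-injective {false} {false} _   = refl
T-injective {false} {true}  b⇔c = ⊥-elim (from b⇔c tt)
T-injective {true}  {false} b⇔c = ⊥-elim (to b⇔c tt)
T-injective {true}  {true}  _   = refl

¬T⇒≡false : ∀ {b} → ¬ T b → b ≡ false
¬T⇒≡false {false} _  = refl
¬T⇒≡false {true}  ¬t = ⊥-elim (¬t tt)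

¬T⇒T-not : ∀ {b} → ¬ T b → T (not b)
¬T⇒T-not {false} _  = tt
¬T⇒T-not {true}  ¬t = ¬t tt

T-not⇒¬T : ∀ {b} → T (not b) → ¬ T b
T-not⇒¬T {false} _ ()

≢⇒≡ᵇ-false : ∀ {m n} → m ≢ n → (m ≡ᵇ n) ≡ false
≢⇒≡ᵇ-false {m} {n} m≢n = ¬T⇒≡false (m≢n ∘ ≡ᵇ⇒≡ m n)

≡⇒≡ᵇ-true : ∀ {m n} → m ≡ n → (m ≡ᵇ n) ≡ true
≡⇒≡ᵇ-true {m} {n} m≡n = to T-≡ (≡⇒≡ᵇ m n m≡n)

𝟙[b∧false]≡0 : ∀ b → 𝟙 (b ∧ false) ≡ 0
𝟙[b∧false]≡0 b = cong 𝟙 (∧-zeroʳ b)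

𝟙[m<ᵇn]+n∸[1+m]≡n∸m : ∀ m n → 𝟙 (m <ᵇ n) + (n ∸ suc m) ≡ n ∸ m
𝟙[m<ᵇn]+n∸[1+m]≡n∸m zero    zero    = refl
𝟙[m<ᵇn]+n∸[1+m]≡n∸m zero    (suc n) = refl
𝟙[m<ᵇn]+n∸[1+m]≡n∸m (suc m) zero    = refl
𝟙[m<ᵇn]+n∸[1+m]≡n∸m (suc m) (suc n) = 𝟙[m<ᵇn]+n∸[1+m]≡n∸m m n

m+n≡o+p∧p≤n⇒m≤o : ∀ {m n o p} → m + n ≡ o + p → p ≤ n → m ≤ o
m+n≡o+p∧p≤n⇒m≤o {m} {n} {o} {p} eq p≤n = +-cancelʳ-≤ n m o (subst (_≤ o + n) (sym eq) (+-monoʳ-≤ o p≤n))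

m+n≡o+p∧o<m⇒n<p : ∀ {m n o p} → m + n ≡ o + p → o < m → n < p
m+n≡o+p∧o<m⇒n<p eq o<m = ≰⇒> (λ p≤n → <⇒≱ o<m (m+n≡o+p∧p≤n⇒m≤o eq p≤n))

m+n≡o+p∧n<p⇒o<m : ∀ {m n o p} → m + n ≡ o + p → n < p → o < m
m+n≡o+p∧n<p⇒o<m {m} {n} {o} {p} eq n<p =
  ≰⇒> (λ m≤o → <⇒≱ n<p (m+n≡o+p∧p≤n⇒m≤o (trans (+-comm p o) (trans (sym eq) (+-comm m n))) m≤o))

m+n≡o+p⇒m∸o≡p∸n : ∀ m n o p → m + n ≡ o + p → m ∸ o ≡ p ∸ n
m+n≡o+p⇒m∸o≡p∸n zero    n zero    p eq = sym (trans (cong (_∸ n) (sym eq)) (n∸n≡0 n))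
m+n≡o+p⇒m∸o≡p∸n zero    n (suc o) p eq = sym (m≤n⇒m∸n≡0 (subst (p ≤_) (sym eq) (m≤n+m p (suc o))))
m+n≡o+p⇒m∸o≡p∸n (suc m) n zero    p eq = sym (trans (cong (_∸ n) (sym eq)) (m+n∸n≡m (suc m) n))
m+n≡o+p⇒m∸o≡p∸n (suc m) n (suc o) p eq = m+n≡o+p⇒m∸o≡p∸n m n o p (suc-injective eq)

m+n≤o⇔n≤o∸m : ∀ {m n o} → m ≤ o → m + n ≤ o ⇔ n ≤ o ∸ m
m+n≤o⇔n≤o∸m {m} {n} {o} m≤o = mk⇔
  (λ m+n≤o → m+n≤o⇒m≤o∸n n (subst (_≤ o) (+-comm m n) m+n≤o))
  (λ n≤o∸m → subst (_≤ o) (+-comm n m) (m≤o∸n⇒m+n≤o n m≤o n≤o∸m))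

m+n≡o⇒n≡o∸m : ∀ m {n o} → m + n ≡ o → n ≡ o ∸ m
m+n≡o⇒n≡o∸m m {n} m+n≡o = trans (sym (m+n∸m≡n m n)) (cong (_∸ m) m+n≡o)

∑< : ℕ → (ℕ → ℕ) → ℕ
∑< zero    f = 0
∑< (suc n) f = f 0 + ∑< n (f ∘ suc)

syntax ∑< n (λ k → e) = ∑[ k < n ] e

∑<-cong : ∀ n {f g : ℕ → ℕ} → (∀ k → k < n → f k ≡ g k) → ∑< n f ≡ ∑< n g
∑<-cong zero    f≡g = refl
∑<-cong (suc n) f≡g = cong₂ _+_ (f≡g 0 z<s) (∑<-cong n (λ k k<n → f≡g (suc k) (s<s k<n)))

∑<-zero : ∀ n {f : ℕ → ℕ} → (∀ k → k < n → f k ≡ 0) → ∑< n f ≡ 0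
∑<-zero zero    f≡0 = refl
∑<-zero (suc n) f≡0 = cong₂ _+_ (f≡0 0 z<s) (∑<-zero n (λ k k<n → f≡0 (suc k) (s<s k<n)))

∑<-single : ∀ n {k} {f : ℕ → ℕ} → k < n → (∀ j → j < n → j ≢ k → f j ≡ 0) → ∑< n f ≡ f k
∑<-single (suc n) {zero} {f} _ f≡0 = begin
  f 0 + ∑< n (f ∘ suc) ≡⟨ cong (f 0 +_) (∑<-zero n (λ j j<n → f≡0 (suc j) (s<s j<n) λ ())) ⟩
  f 0 + 0              ≡⟨ +-identityʳ (f 0) ⟩
  f 0                  ∎
  where open ≡-Reasoning
∑<-single (suc n) {suc k} (s≤s k<n) f≡0 = cong₂ _+_ (f≡0 0 z<s λ ())
  (∑<-single n k<n (λ j j<n j≢k → f≡0 (suc j) (s<s j<n) (j≢k ∘ suc-injective)))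

∑<-dropZeros : ∀ {x n} {f : ℕ → ℕ} → x ≤ n → (∀ a → a < x → f a ≡ 0) →
               ∑< n f ≡ ∑[ k < n ∸ x ] f (x + k)
∑<-dropZeros {zero}          _         _   = refl
∑<-dropZeros {suc x} {suc n} (s≤s x≤n) f≡0 =
  cong₂ _+_ (f≡0 0 z<s) (∑<-dropZeros x≤n (λ a a<x → f≡0 (suc a) (s<s a<x)))

∑<-padZeros : ∀ {K K'} {f : ℕ → ℕ} → K ≤ K' → (∀ k → K ≤ k → k < K' → f k ≡ 0) → ∑< K f ≡ ∑< K' f
∑<-padZeros {zero}  {K'} _ f≡0 = sym (∑<-zero K' (λ k k<K' → f≡0 k z≤n k<K'))
∑<-padZeros {suc K} {suc K'} (s≤s K≤K') f≡0 =
  cong (_ +_) (∑<-padZeros K≤K' (λ k K≤k k<K' → f≡0 (suc k) (s≤s K≤k) (s<s k<K')))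

∑<-interval : ∀ m {X Y} → Y ≤ X → X ≤ m → ∑[ a < m ] 𝟙 ((a <ᵇ X) ∧ not (a <ᵇ Y)) ≡ X ∸ Y
∑<-interval m       {zero}  {zero}  _         _         = ∑<-zero m (λ _ _ → refl)
∑<-interval (suc m) {suc X} {zero}  _         (s≤s X≤m) = cong suc (∑<-interval m z≤n X≤m)
∑<-interval (suc m) {suc X} {suc Y} (s≤s Y≤X) (s≤s X≤m) = ∑<-interval m Y≤X X≤m

∑<-antidiagonal : ∀ n {a i} (f : ℕ → Bool) → (∀ b → T (f b) → b < n) →
                  ∑[ b < n ] 𝟙 (f b ∧ (a + b ≡ᵇ i)) ≡ 𝟙 ((a ≤ᵇ i) ∧ f (i ∸ a))
∑<-antidiagonal n {a} {i} f f⇒<n with a ≤? i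
... | no a≰i = trans (∑<-zero n off-antidiagonal) (sym (cong (λ c → 𝟙 (c ∧ f (i ∸ a))) (¬T⇒≡false (a≰i ∘ ≤ᵇ⇒≤ a i))))
  where
  off-antidiagonal : ∀ b → b < n → 𝟙 (f b ∧ (a + b ≡ᵇ i)) ≡ 0
  off-antidiagonal b _ rewrite ≢⇒≡ᵇ-false {a + b} {i} (λ a+b≡i → a≰i (subst (a ≤_) a+b≡i (m≤m+n a b))) =
    𝟙[b∧false]≡0 (f b)
... | yes a≤i with i ∸ a <? n
...   | yes k<n = trans (∑<-single n k<n off-k) on-k
  where
  k = i ∸ a
  off-k : ∀ b → b < n → b ≢ k → 𝟙 (f b ∧ (a + b ≡ᵇ i)) ≡ 0
  off-k b _ b≢k rewrite ≢⇒≡ᵇ-false {a + b} {i} (b≢k ∘ m+n≡o⇒n≡o∸m a) =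
    𝟙[b∧false]≡0 (f b)
  on-k : 𝟙 (f k ∧ (a + k ≡ᵇ i)) ≡ 𝟙 ((a ≤ᵇ i) ∧ f k)
  on-k rewrite ≡⇒≡ᵇ-true (m+[n∸m]≡n a≤i) | to T-≡ (≤⇒≤ᵇ a≤i) = cong 𝟙 (∧-identityʳ (f k))
...   | no k≮n = trans (∑<-zero n off-range) (sym (cong 𝟙 (trans (cong ((a ≤ᵇ i) ∧_) fk≡false) (∧-zeroʳ _))))
  where
  off-range : ∀ b → b < n → 𝟙 (f b ∧ (a + b ≡ᵇ i)) ≡ 0
  off-range b b<n rewrite ≢⇒≡ᵇ-false {a + b} {i} (λ a+b≡i → k≮n (subst (_< n) (m+n≡o⇒n≡o∸m a a+b≡i) b<n)) =
    𝟙[b∧false]≡0 (f b)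
  fk≡false : f (i ∸ a) ≡ false
  fk≡false = ¬T⇒≡false (k≮n ∘ f⇒<n (i ∸ a))

count : {A : Set} → (A → Bool) → List A → ℕ
count f xs = length (filter (λ s → f s Data.Bool.≟ true) xs)

count-++ : ∀ {A : Set} (f : A → Bool) xs ys → count f (xs ++ ys) ≡ count f xs + count f ys
count-++ f xs ys = trans (cong length (filter-++ _ xs ys)) (length-++ (filter _ xs))

count-map-applyUpTo : ∀ {A : Set} (f : A → Bool) (g : ℕ → A) (h : ℕ → ℕ) n →
                      count f (map g (applyUpTo h n)) ≡ ∑[ b < n ] 𝟙 (f (g (h b)))
count-map-applyUpTo f g h zero = refl
count-map-applyUpTo f g h (suc n) with f (g (h 0))
... | true  = cong suc (count-map-applyUpTo f g (h ∘ suc) n)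
... | false = count-map-applyUpTo f g (h ∘ suc) n

count-concatMap-applyUpTo : ∀ {A : Set} (f : A → Bool) (g : ℕ → List A) (h : ℕ → ℕ) m →
                            count f (concatMap g (applyUpTo h m)) ≡ ∑[ a < m ] count f (g (h a))
count-concatMap-applyUpTo f g h zero    = refl
count-concatMap-applyUpTo f g h (suc m) =
  trans (count-++ f (g (h 0)) _) (cong (_ +_) (count-concatMap-applyUpTo f g (h ∘ suc) m))

countSq≡∑< : ∀ {m n} (P : Polyo m n) f → countSq P f ≡ ∑[ a < m ] ∑[ b < n ] 𝟙 (f (a , b))
countSq≡∑< {m} {n} P f =
  trans (count-concatMap-applyUpTo f (λ a → map (a ,_) (upTo n)) (λ a → a) m)
        (∑<-cong m (λ a _ → count-map-applyUpTo f (a ,_) (λ b → b) n))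

xAt yAt : List Step → ℕ → ℕ
xAt p j = countE (take j p)
yAt p j = countN (take j p)

isEAt : List Step → ℕ → Bool
isEAt []      _       = false
isEAt (s ∷ p) zero    = isE s
isEAt (s ∷ p) (suc j) = isEAt p j

stepIsE≡isEAt : ∀ {m n} (P : Polyo m n) p j → stepIsE P p j ≡ isEAt p j
stepIsE≡isEAt P []      j       = refl
stepIsE≡isEAt P (s ∷ p) zero    = refl
stepIsE≡isEAt P (s ∷ p) (suc j) = stepIsE≡isEAt P p j

countE-++ : ∀ p q → countE (p ++ q) ≡ countE p + countE q
countE-++ []      q = refl
countE-++ (N ∷ p) q = countE-++ p q
countE-++ (E ∷ p) q = cong suc (countE-++ p q)

countN-++ : ∀ p q → countN (p ++ q) ≡ countN p + countN q
countN-++ []      q = refl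
countN-++ (N ∷ p) q = cong suc (countN-++ p q)
countN-++ (E ∷ p) q = countN-++ p q

countE+countN≡length : ∀ p → countE p + countN p ≡ length p
countE+countN≡length []      = refl
countE+countN≡length (N ∷ p) = trans (+-suc (countE p) _) (cong suc (countE+countN≡length p))
countE+countN≡length (E ∷ p) = cong suc (countE+countN≡length p)

xAt+yAt≡index : ∀ p {j} → j ≤ length p → xAt p j + yAt p j ≡ j
xAt+yAt≡index p       {zero}  _           = refl
xAt+yAt≡index (N ∷ p) {suc j} (s≤s j≤∣p∣) = trans (+-suc (xAt p j) _) (cong suc (xAt+yAt≡index p j≤∣p∣))
xAt+yAt≡index (E ∷ p) {suc j} (s≤s j≤∣p∣) = cong suc (xAt+yAt≡index p j≤∣p∣)

yAt-mono : ∀ p {j j'} → j ≤ j' → yAt p j ≤ yAt p j'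
yAt-mono p       {zero}            _         = z≤n
yAt-mono []      {suc j}           _         = z≤n
yAt-mono (N ∷ p) {suc j} {suc j'} (s≤s j≤j') = s≤s (yAt-mono p j≤j')
yAt-mono (E ∷ p) {suc j} {suc j'} (s≤s j≤j') = yAt-mono p j≤j'

xAt≤countE : ∀ p j → xAt p j ≤ countE p
xAt≤countE p       zero    = z≤n
xAt≤countE []      (suc j) = z≤n
xAt≤countE (N ∷ p) (suc j) = xAt≤countE p j
xAt≤countE (E ∷ p) (suc j) = s≤s (xAt≤countE p j)

yAt≤countN : ∀ p j → yAt p j ≤ countN p
yAt≤countN p       zero    = z≤n
yAt≤countN []      (suc j) = z≤n
yAt≤countN (N ∷ p) (suc j) = s≤s (yAt≤countN p j)
yAt≤countN (E ∷ p) (suc j) = yAt≤countN p j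

eHeight≤countN : ∀ p a → eHeight p a ≤ countN p
eHeight≤countN []      a       = z≤n
eHeight≤countN (N ∷ p) a       = s≤s (eHeight≤countN p a)
eHeight≤countN (E ∷ p) zero    = z≤n
eHeight≤countN (E ∷ p) (suc a) = eHeight≤countN p a

yAt-[] : ∀ j → yAt [] j ≡ 0
yAt-[] j = cong countN (take-[] j)

-- The East step of p in column a is step number a + eHeight p a.
a+eHeight≤i⇔a<xAt[1+i] : ∀ p {a} i → a < countE p → a + eHeight p a ≤ i ⇔ a < xAt p (suc i)
a+eHeight≤i⇔a<xAt[1+i] p i a<∣p∣ = mk⇔ (before p i a<∣p∣) (after p i a<∣p∣)
  where
  before : ∀ p {a} i → a < countE p → a + eHeight p a ≤ i → a < xAt p (suc i)
  before (N ∷ p) {a} zero    _     a+h≤0 = contradiction (subst (_≤ 0) (+-suc a _) a+h≤0) λ ()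
  before (N ∷ p) {a} (suc i) a<∣p∣ a+h≤i = before p i a<∣p∣ (≤-pred (subst (_≤ suc i) (+-suc a _) a+h≤i))
  before (E ∷ p) {zero}  i       _           _           = z<s
  before (E ∷ p) {suc a} (suc i) (s≤s a<∣p∣) (s≤s a+h≤i) = s<s (before p i a<∣p∣ a+h≤i)
  after : ∀ p {a} i → a < countE p → a < xAt p (suc i) → a + eHeight p a ≤ i
  after (N ∷ p) {a} zero    _     ()
  after (N ∷ p) {a} (suc i) a<∣p∣ a<x = subst (_≤ suc i) (sym (+-suc a _)) (s≤s (after p i a<∣p∣ a<x))
  after (E ∷ p) {zero}  i       _           _         = z≤n
  after (E ∷ p) {suc a} zero    _           (s≤s ())
  after (E ∷ p) {suc a} (suc i) (s≤s a<∣p∣) (s≤s a<x) = s≤s (after p i a<∣p∣ a<x)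

take-+ : ∀ i k (p : List Step) → take (i + k) p ≡ take i p ++ take k (drop i p)
take-+ zero    k       p       = refl
take-+ (suc i) zero    []      = refl
take-+ (suc i) (suc k) []      = refl
take-+ (suc i) k       (s ∷ p) = cong (s ∷_) (take-+ i k p)

yAt-+ : ∀ p i k → yAt p (i + k) ≡ yAt p i + yAt (drop i p) k
yAt-+ p i k = trans (cong countN (take-+ i k p)) (countN-++ (take i p) _)

isEAt-+ : ∀ p i k → isEAt p (i + k) ≡ isEAt (drop i p) k
isEAt-+ p       zero    k = refl
isEAt-+ []      (suc i) k = refl
isEAt-+ (s ∷ p) (suc i) k = isEAt-+ p i k

xAt-suc : ∀ p j → xAt p (suc j) ≡ xAt p j + 𝟙 (isEAt p j)
xAt-suc []      zero    = refl
xAt-suc []      (suc j) = refl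
xAt-suc (N ∷ p) zero    = refl
xAt-suc (E ∷ p) zero    = refl
xAt-suc (N ∷ p) (suc j) = xAt-suc p j
xAt-suc (E ∷ p) (suc j) = cong suc (xAt-suc p j)

drop≡∷⇒drop-suc : ∀ i (p : List Step) {u us} → drop i p ≡ u ∷ us → drop (suc i) p ≡ us
drop≡∷⇒drop-suc zero    (s ∷ p) refl = refl
drop≡∷⇒drop-suc (suc i) (s ∷ p) eq   = drop≡∷⇒drop-suc i p eq

drop≡∷⇒take-suc : ∀ i (p : List Step) {u us} → drop i p ≡ u ∷ us → take (suc i) p ≡ take i p ++ u ∷ []
drop≡∷⇒take-suc zero    (s ∷ p) refl = refl
drop≡∷⇒take-suc (suc i) (s ∷ p) eq   = cong (s ∷_) (drop≡∷⇒take-suc i p eq)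

drop≡∷⇒<length : ∀ i (p : List Step) {u us} → drop i p ≡ u ∷ us → i < length p
drop≡∷⇒<length zero    (s ∷ p) eq = z<s
drop≡∷⇒<length (suc i) (s ∷ p) eq = s<s (drop≡∷⇒<length i p eq)

drop≡∷⇒yAt-suc : ∀ i (p : List Step) {u us} → drop i p ≡ u ∷ us → yAt p (suc i) ≡ yAt p i + 𝟙 (isN u)
drop≡∷⇒yAt-suc i p {N} eq = trans (cong countN (drop≡∷⇒take-suc i p eq)) (countN-++ (take i p) (N ∷ []))
drop≡∷⇒yAt-suc i p {E} eq = trans (cong countN (drop≡∷⇒take-suc i p eq)) (countN-++ (take i p) (E ∷ []))

northSteps-below : ∀ q c r K → length q ≤ K → r ≤ c + countN q →
                   ∑[ k < K ] 𝟙 (not (isEAt q k) ∧ (c + yAt q k <ᵇ r)) ≡ r ∸ c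
northSteps-below [] c r K _ r≤c+0 = trans (∑<-zero K above) (sym (m≤n⇒m∸n≡0 (subst (r ≤_) (+-identityʳ c) r≤c+0)))
  where
  above : ∀ k → k < K → 𝟙 (not false ∧ (c + yAt [] k <ᵇ r)) ≡ 0
  above k _ rewrite yAt-[] k | +-identityʳ c | ¬T⇒≡false (λ t → <⇒≱ (<ᵇ⇒< c r t) r≤c+0) = refl
northSteps-below (E ∷ q) c r (suc K) (s≤s ∣q∣≤K) r≤ = northSteps-below q c r K ∣q∣≤K r≤
northSteps-below (N ∷ q) c r (suc K) (s≤s ∣q∣≤K) r≤ = begin
  𝟙 (c + 0 <ᵇ r) + ∑[ k < K ] 𝟙 (not (isEAt q k) ∧ (c + suc (yAt q k) <ᵇ r))
    ≡⟨ cong₂ _+_ (cong (λ c' → 𝟙 (c' <ᵇ r)) (+-identityʳ c))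
                 (∑<-cong K (λ k _ → cong (λ c' → 𝟙 (not (isEAt q k) ∧ (c' <ᵇ r))) (+-suc c (yAt q k)))) ⟩
  𝟙 (c <ᵇ r) + ∑[ k < K ] 𝟙 (not (isEAt q k) ∧ (suc c + yAt q k <ᵇ r))
    ≡⟨ cong (𝟙 (c <ᵇ r) +_) (northSteps-below q (suc c) r K ∣q∣≤K (subst (r ≤_) (+-suc c _) r≤)) ⟩
  𝟙 (c <ᵇ r) + (r ∸ suc c)
    ≡⟨ 𝟙[m<ᵇn]+n∸[1+m]≡n∸m c r ⟩
  r ∸ c ∎
  where open ≡-Reasoning

index∸countE≤yAt : ∀ p {j} → j ≤ length p → j ∸ countE p ≤ yAt p j
index∸countE≤yAt p {j} j≤∣p∣ = begin
  j ∸ countE p                ≤⟨ ∸-monoʳ-≤ j (xAt≤countE p j) ⟩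
  j ∸ xAt p j                 ≡⟨ cong (_∸ xAt p j) (xAt+yAt≡index p j≤∣p∣) ⟨
  xAt p j + yAt p j ∸ xAt p j ≡⟨ m+n∸m≡n (xAt p j) (yAt p j) ⟩
  yAt p j                     ∎
  where open ≤-Reasoning

rowLabel-double : ∀ d → rowLabel (d + d) ≡ bar d
rowLabel-double zero    = refl
rowLabel-double (suc d) rewrite +-suc d d = cong incr (rowLabel-double d)

rowLabel-double+1 : ∀ d → rowLabel (suc (d + d)) ≡ unbar (suc d)
rowLabel-double+1 zero    = refl
rowLabel-double+1 (suc d) rewrite +-suc d d = cong incr (rowLabel-double+1 d)

rowLabel-double∸1 : ∀ {d} → 0 < d → rowLabel (d + d ∸ 1) ≡ unbar d
rowLabel-double∸1 {suc d} _ rewrite +-suc d d = rowLabel-double+1 d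

suc[m+m∸1]≡m+m : ∀ {m} → 0 < m → suc (m + m ∸ 1) ≡ m + m
suc[m+m∸1]≡m+m {suc m} _ = refl

[m+m]∸1∸1≡[m∸1]+[m∸1] : ∀ m → m + m ∸ 1 ∸ 1 ≡ (m ∸ 1) + (m ∸ 1)
[m+m]∸1∸1≡[m∸1]+[m∸1] zero    = refl
[m+m]∸1∸1≡[m∸1]+[m∸1] (suc m) = cong (_∸ 1) (+-suc m m)

module _ {m n : ℕ} (P : Polyo m n) where

  private
    U L : List Step
    U = upper P
    L = lower P

  length-upper : length U ≡ m + n
  length-upper = trans (sym (countE+countN≡length U)) (cong₂ _+_ (proj₁ (upper-path P)) (proj₂ (upper-path P)))

  length-lower : length L ≡ m + n
  length-lower = trans (sym (countE+countN≡length L)) (cong₂ _+_ (proj₁ (lower-path P)) (proj₂ (lower-path P)))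

  upper-index : ∀ {j} → j ≤ m + n → xAt U j + yAt U j ≡ j
  upper-index j≤ = xAt+yAt≡index U (subst (_ ≤_) (sym length-upper) j≤)

  lower-index : ∀ {j} → j ≤ m + n → xAt L j + yAt L j ≡ j
  lower-index j≤ = xAt+yAt≡index L (subst (_ ≤_) (sym length-lower) j≤)

  gap : ℕ → ℕ
  gap j = yAt U j ∸ yAt L j

  xAt-upper≤xAt-lower : ∀ {j} → j ≤ m + n → xAt U j ≤ xAt L j
  xAt-upper≤xAt-lower {j} j≤ = m+n≡o+p∧p≤n⇒m≤o (trans (upper-index j≤) (sym (lower-index j≤))) (weakly-above P j)

  gap≡xAt-lower∸xAt-upper : ∀ {j} → j ≤ m + n → gap j ≡ xAt L j ∸ xAt U j
  gap≡xAt-lower∸xAt-upper {j} j≤ =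
    sym (m+n≡o+p⇒m∸o≡p∸n (xAt L j) (yAt L j) (xAt U j) (yAt U j) (trans (lower-index j≤) (sym (upper-index j≤))))

  gap-positive : ∀ {j} → 0 < j → j < m + n → 0 < gap j
  gap-positive {j} 0<j j<m+n = m<n⇒0<n∸m (≤∧≢⇒< (weakly-above P j) yL≢yU)
    where
    yL≢yU : yAt L j ≢ yAt U j
    yL≢yU yL≡yU = meet-only-ends P j 0<j j<m+n (cong₂ _,_ xU≡xL (sym yL≡yU))
      where
      xU≡xL : xAt U j ≡ xAt L j
      xU≡xL = +-cancelʳ-≡ (yAt U j) (xAt U j) (xAt L j)
        (trans (upper-index (<⇒≤ j<m+n)) (trans (sym (lower-index (<⇒≤ j<m+n))) (cong (xAt L j +_) yL≡yU)))

  -- The gap vanishes only on antidiagonals 0 and m + n, which are not adjacent when m + n ≥ 2.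
  gap-constant⇒positive : 2 ≤ m + n → ∀ {i} → suc i ≤ m + n → gap (suc i) ≡ gap i → 0 < gap i
  gap-constant⇒positive 2≤m+n {i} i<m+n gap-const with suc i <? m + n
  ... | yes 1+i<m+n = subst (0 <_) gap-const (gap-positive z<s 1+i<m+n)
  gap-constant⇒positive 2≤m+n {zero}  i<m+n gap-const | no 1≮m+n = contradiction 2≤m+n 1≮m+n
  gap-constant⇒positive 2≤m+n {suc i} i<m+n gap-const | no _     = gap-positive z<s i<m+n

  lowerEast⇔ : ∀ {a} i → a < m → a + eHeight L a ≤ i ⇔ a < xAt L (suc i)
  lowerEast⇔ i a<m = a+eHeight≤i⇔a<xAt[1+i] L i (subst (_ <_) (sym (proj₁ (lower-path P))) a<m)

  upperEast⇔ : ∀ {a} i → a < m → a + eHeight U a ≤ i ⇔ a < xAt U (suc i)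
  upperEast⇔ i a<m = a+eHeight≤i⇔a<xAt[1+i] U i (subst (_ <_) (sym (proj₁ (upper-path P))) a<m)

  interior⇒<n : ∀ a b → T (interior P (a , b)) → b < n
  interior⇒<n a b t = <-≤-trans (<ᵇ⇒< b _ (proj₂ (to T-∧ t)))
    (subst (eHeight U a ≤_) (proj₂ (upper-path P)) (eHeight≤countN U a))

  interior-on-antidiagonal⇔ : ∀ {a} i → a < m →
    T ((a ≤ᵇ i) ∧ interior P (a , i ∸ a)) ⇔ T ((a <ᵇ xAt L (suc i)) ∧ not (a <ᵇ xAt U (suc i)))
  interior-on-antidiagonal⇔ {a} i a<m = mk⇔ inside outside
    where
    inside : T ((a ≤ᵇ i) ∧ interior P (a , i ∸ a)) → T ((a <ᵇ xAt L (suc i)) ∧ not (a <ᵇ xAt U (suc i)))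
    inside t with to T-∧ t
    ... | a≤ᵇi , int with to T-∧ int
    ...   | hL≤ᵇ , <ᵇhU = from T-∧
      ( <⇒<ᵇ (to (lowerEast⇔ i a<m) (from (m+n≤o⇔n≤o∸m a≤i) (≤ᵇ⇒≤ _ _ hL≤ᵇ)))
      , ¬T⇒T-not (λ a<xU → <⇒≱ (<ᵇ⇒< _ _ <ᵇhU)
          (to (m+n≤o⇔n≤o∸m a≤i) (from (upperEast⇔ i a<m) (<ᵇ⇒< a _ a<xU)))) )
      where
      a≤i : a ≤ i
      a≤i = ≤ᵇ⇒≤ a i a≤ᵇi
    outside : T ((a <ᵇ xAt L (suc i)) ∧ not (a <ᵇ xAt U (suc i))) → T ((a ≤ᵇ i) ∧ interior P (a , i ∸ a))
    outside t with to T-∧ t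
    ... | a<ᵇxL , a≮ᵇxU = from T-∧
      ( ≤⇒≤ᵇ a≤i
      , from T-∧ ( ≤⇒≤ᵇ (to (m+n≤o⇔n≤o∸m a≤i) a+hL≤i)
                 , <⇒<ᵇ (≰⇒> (λ hU≤ → T-not⇒¬T a≮ᵇxU
                     (<⇒<ᵇ (to (upperEast⇔ i a<m) (from (m+n≤o⇔n≤o∸m a≤i) hU≤)))))) )
      where
      a+hL≤i : a + eHeight L a ≤ i
      a+hL≤i = from (lowerEast⇔ i a<m) (<ᵇ⇒< a _ a<ᵇxL)
      a≤i : a ≤ i
      a≤i = m+n≤o⇒m≤o a a+hL≤i

  lowerLabel≡gap : ∀ {i} → suc i ≤ m + n → lowerLabel P i ≡ gap (suc i)
  lowerLabel≡gap {i} i<m+n = begin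
    lowerLabel P i
      ≡⟨ countSq≡∑< P (crossedBy P i) ⟩
    ∑[ a < m ] ∑[ b < n ] 𝟙 (interior P (a , b) ∧ (a + b ≡ᵇ i))
      ≡⟨ ∑<-cong m (λ a a<m → trans (∑<-antidiagonal n {a} {i} (λ b → interior P (a , b)) (interior⇒<n a))
                                    (cong 𝟙 (T-injective (interior-on-antidiagonal⇔ i a<m)))) ⟩
    ∑[ a < m ] 𝟙 ((a <ᵇ xAt L (suc i)) ∧ not (a <ᵇ xAt U (suc i)))
      ≡⟨ ∑<-interval m (xAt-upper≤xAt-lower i<m+n)
           (subst (xAt L (suc i) ≤_) (proj₁ (lower-path P)) (xAt≤countE L (suc i))) ⟩
    xAt L (suc i) ∸ xAt U (suc i)
      ≡⟨ sym (gap≡xAt-lower∸xAt-upper i<m+n) ⟩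
    gap (suc i) ∎
    where open ≡-Reasoning

  lowerNorthBelow : ℕ → ℕ → Bool
  lowerNorthBelow y j = not (isEAt L j) ∧ (yAt L j <ᵇ y)

  module _ {i : ℕ} {us : List Step} (N-at-i : drop i U ≡ N ∷ us) where

    private
      x y : ℕ
      x = xAt U i
      y = yAt U i

      i<m+n : i < m + n
      i<m+n = subst (i <_) length-upper (drop≡∷⇒<length i U N-at-i)

      x+y≡i : x + y ≡ i
      x+y≡i = upper-index (<⇒≤ i<m+n)

      yAt-upper-suc : yAt U (suc i) ≡ suc y
      yAt-upper-suc = trans (drop≡∷⇒yAt-suc i U N-at-i) (+-comm y 1)

      y<n : y < n
      y<n = subst (_≤ n) yAt-upper-suc (subst (yAt U (suc i) ≤_) (proj₂ (upper-path P)) (yAt≤countN U (suc i)))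

      x≤m : x ≤ m
      x≤m = subst (x ≤_) (proj₁ (upper-path P)) (xAt≤countE U i)

    -- A square east of the step is uncrossed iff its antidiagonal line was not drawn, i.e. the lower
    -- path takes a North step there; being interior then just says that step lies below row y.
    uncrossed⇔lowerNorthBelow : ∀ {a} → a < m →
      T (interior P (a , y) ∧ ((y ≡ᵇ y) ∧ ((x ≤ᵇ a) ∧ not (crossed P (a , y)))))
        ⇔ T ((x ≤ᵇ a) ∧ lowerNorthBelow y (a + y))
    uncrossed⇔lowerNorthBelow {a} a<m = mk⇔ uncrossed⇒ ⇒uncrossed
      where
      j = a + y
      j<m+n : j < m + n
      j<m+n = +-mono-< a<m y<n
      lower-index-j : xAt L j + yAt L j ≡ a + y
      lower-index-j = lower-index (<⇒≤ j<m+n)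
      northStep⇒xAt-suc : isEAt L j ≡ false → xAt L (suc j) ≡ xAt L j
      northStep⇒xAt-suc isE≡false = trans (xAt-suc L j) (trans (cong (λ e → xAt L j + 𝟙 e) isE≡false) (+-identityʳ _))

      uncrossed⇒ : T (interior P (a , y) ∧ ((y ≡ᵇ y) ∧ ((x ≤ᵇ a) ∧ not (crossed P (a , y)))))
                 → T ((x ≤ᵇ a) ∧ lowerNorthBelow y j)
      uncrossed⇒ t with to T-∧ t
      ... | int , rest with to T-∧ (proj₂ (to (T-∧ {y ≡ᵇ y}) rest))
      ...   | x≤ᵇa , ¬crossed = from T-∧ (x≤ᵇa , from T-∧ (from T-not-≡ isE≡false , <⇒<ᵇ yL<y))
        where
        isE≡false : isEAt L j ≡ false
        isE≡false = ¬T⇒≡false (λ isE → T-not⇒¬T ¬crossed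
          (from T-∧ (int , subst T (sym (stepIsE≡isEAt P L j)) isE)))
        a<xL : a < xAt L j
        a<xL = subst (a <_) (northStep⇒xAt-suc isE≡false)
          (to (lowerEast⇔ j a<m) (+-monoʳ-≤ a (≤ᵇ⇒≤ _ _ (proj₁ (to T-∧ int)))))
        yL<y : yAt L j < y
        yL<y = m+n≡o+p∧o<m⇒n<p lower-index-j a<xL

      ⇒uncrossed : T ((x ≤ᵇ a) ∧ lowerNorthBelow y j)
                 → T (interior P (a , y) ∧ ((y ≡ᵇ y) ∧ ((x ≤ᵇ a) ∧ not (crossed P (a , y)))))
      ⇒uncrossed t with to T-∧ t
      ... | x≤ᵇa , nb with to T-∧ nb
      ...   | notE , yL<ᵇy = from T-∧ (int , from T-∧ (≡⇒≡ᵇ y y refl , from T-∧ (x≤ᵇa , ¬T⇒T-not uncrossed)))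
        where
        isE≡false : isEAt L j ≡ false
        isE≡false = to T-not-≡ notE
        a<xL : a < xAt L (suc j)
        a<xL = subst (a <_) (sym (northStep⇒xAt-suc isE≡false))
          (m+n≡o+p∧n<p⇒o<m lower-index-j (<ᵇ⇒< _ _ yL<ᵇy))
        hL≤y : eHeight L a ≤ y
        hL≤y = +-cancelˡ-≤ a _ _ (from (lowerEast⇔ j a<m) a<xL)
        xU≤a : xAt U (suc j) ≤ a
        xU≤a = m+n≡o+p∧p≤n⇒m≤o (trans (upper-index j<m+n) (sym (+-suc a y)))
          (subst (_≤ yAt U (suc j)) yAt-upper-suc
            (yAt-mono U (s≤s (subst (_≤ j) x+y≡i (+-monoˡ-≤ y (≤ᵇ⇒≤ x a x≤ᵇa))))))
        y<hU : y < eHeight U a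
        y<hU = ≰⇒> (λ hU≤y → <⇒≱ (to (upperEast⇔ j a<m) (+-monoʳ-≤ a hU≤y)) xU≤a)
        int : T (interior P (a , y))
        int = from T-∧ (≤⇒≤ᵇ hL≤y , <⇒<ᵇ y<hU)
        uncrossed : ¬ T (crossed P (a , y))
        uncrossed cr = subst T (trans (stepIsE≡isEAt P L j) isE≡false) (proj₂ (to T-∧ cr))

    private
      x+k+y≡i+k : ∀ k → x + k + y ≡ i + k
      x+k+y≡i+k k = begin
        x + k + y   ≡⟨ +-assoc x k y ⟩
        x + (k + y) ≡⟨ cong (x +_) (+-comm k y) ⟩
        x + (y + k) ≡⟨ +-assoc x y k ⟨
        x + y + k   ≡⟨ cong (_+ k) x+y≡i ⟩
        i + k       ∎
        where open ≡-Reasoning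

      y≤yAt[i+k] : ∀ k → m ∸ x ≤ k → y ≤ yAt L i + yAt (drop i L) k
      y≤yAt[i+k] k m∸x≤k = begin
        y                   ≡⟨ m+n∸m≡n m y ⟨
        m + y ∸ m           ≡⟨ cong (m + y ∸_) (proj₁ (lower-path P)) ⟨
        m + y ∸ countE L    ≤⟨ index∸countE≤yAt L (subst (m + y ≤_) (sym length-lower) (+-monoʳ-≤ m (<⇒≤ y<n))) ⟩
        yAt L (m + y)       ≤⟨ yAt-mono L m+y≤i+k ⟩
        yAt L (i + k)       ≡⟨ yAt-+ L i k ⟩
        yAt L i + yAt (drop i L) k   ∎
        where
        open ≤-Reasoning
        m+y≤i+k : m + y ≤ i + k
        m+y≤i+k = subst (m + y ≤_) (x+k+y≡i+k k) (+-monoˡ-≤ y (≤-trans (m≤n+m∸n m x) (+-monoʳ-≤ x m∸x≤k)))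

    upperLabel≡gap : upperLabel P i ≡ gap i
    upperLabel≡gap = begin
      upperLabel P i
        ≡⟨ countSq≡∑< P _ ⟩
      ∑[ a < m ] ∑[ b < n ] 𝟙 (interior P (a , b) ∧ ((b ≡ᵇ y) ∧ ((x ≤ᵇ a) ∧ not (crossed P (a , b)))))
        ≡⟨ ∑<-cong m (λ a _ → ∑<-single n y<n (λ b _ b≢y → outside-row a b b≢y)) ⟩
      ∑[ a < m ] 𝟙 (interior P (a , y) ∧ ((y ≡ᵇ y) ∧ ((x ≤ᵇ a) ∧ not (crossed P (a , y)))))
        ≡⟨ ∑<-cong m (λ a a<m → cong 𝟙 (T-injective (uncrossed⇔lowerNorthBelow a<m))) ⟩
      ∑[ a < m ] 𝟙 ((x ≤ᵇ a) ∧ lowerNorthBelow y (a + y))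
        ≡⟨ ∑<-dropZeros x≤m west-of-step ⟩
      ∑[ k < m ∸ x ] 𝟙 ((x ≤ᵇ x + k) ∧ lowerNorthBelow y (x + k + y))
        ≡⟨ ∑<-cong (m ∸ x) (λ k _ → cong 𝟙 (reindex k)) ⟩
      ∑[ k < m ∸ x ] 𝟙 (not (isEAt q k) ∧ (yAt L i + yAt q k <ᵇ y))
        ≡⟨ ∑<-padZeros (≤-trans (m∸n≤m m x) (m≤m+n m n)) above-row ⟩
      ∑[ k < m + n ] 𝟙 (not (isEAt q k) ∧ (yAt L i + yAt q k <ᵇ y))
        ≡⟨ northSteps-below q (yAt L i) y (m + n) ∣q∣≤m+n y≤yAt[i]+countN[q] ⟩
      gap i ∎
      where
      open ≡-Reasoning
      q = drop i L

      outside-row : ∀ a b → b ≢ y → 𝟙 (interior P (a , b) ∧ ((b ≡ᵇ y) ∧ ((x ≤ᵇ a) ∧ not (crossed P (a , b))))) ≡ 0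
      outside-row a b b≢y rewrite ≢⇒≡ᵇ-false b≢y = 𝟙[b∧false]≡0 (interior P (a , b))

      west-of-step : ∀ a → a < x → 𝟙 ((x ≤ᵇ a) ∧ lowerNorthBelow y (a + y)) ≡ 0
      west-of-step a a<x rewrite ¬T⇒≡false (λ x≤ᵇa → <⇒≱ a<x (≤ᵇ⇒≤ x a x≤ᵇa)) = refl

      reindex : ∀ k → (x ≤ᵇ x + k) ∧ lowerNorthBelow y (x + k + y) ≡ not (isEAt q k) ∧ (yAt L i + yAt q k <ᵇ y)
      reindex k rewrite to T-≡ (≤⇒≤ᵇ (m≤m+n x k)) | x+k+y≡i+k k | isEAt-+ L i k | yAt-+ L i k = refl

      above-row : ∀ k → m ∸ x ≤ k → k < m + n → 𝟙 (not (isEAt q k) ∧ (yAt L i + yAt q k <ᵇ y)) ≡ 0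
      above-row k m∸x≤k _ rewrite ¬T⇒≡false (λ t → <⇒≱ (<ᵇ⇒< _ y t) (y≤yAt[i+k] k m∸x≤k)) = 𝟙[b∧false]≡0 _

      ∣q∣≤m+n : length q ≤ m + n
      ∣q∣≤m+n = subst (_≤ m + n) (sym (length-drop i L)) (≤-trans (m∸n≤m _ i) (≤-reflexive length-lower))

      y≤yAt[i]+countN[q] : y ≤ yAt L i + countN q
      y≤yAt[i]+countN[q] = subst (y ≤_)
        (trans (sym (proj₂ (lower-path P))) (trans (cong countN (sym (take++drop≡id i L))) (countN-++ (take i L) q)))
        (<⇒≤ y<n)

  gap-suc : ∀ {i u l us ls} → drop i U ≡ u ∷ us → drop i L ≡ l ∷ ls →
            gap (suc i) ≡ (yAt U i + 𝟙 (isN u)) ∸ (yAt L i + 𝟙 (isN l))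
  gap-suc {i} u-at-i l-at-i = cong₂ _∸_ (drop≡∷⇒yAt-suc i U u-at-i) (drop≡∷⇒yAt-suc i L l-at-i)

  riseLabels≡areaWordFrom : 2 ≤ m + n → ∀ i {us ls} h → drop i U ≡ us → drop i L ≡ ls → h ≡ gap i + gap i →
                            riseLabels h (ptdPath us ls) ≡ areaWordFrom P i us ls
  riseLabels≡areaWordFrom _ i {[]}              h _ _ _ = refl
  riseLabels≡areaWordFrom _ i {_ ∷ _} {[]}      h _ _ _ = refl
  riseLabels≡areaWordFrom 2≤m+n i {u ∷ us} {l ∷ ls} .(gap i + gap i) u-at-i l-at-i refl = step u l u-at-i l-at-i
    where
    g = gap i
    yU = yAt U i
    yL = yAt L i
    i<m+n : suc i ≤ m + n
    i<m+n = subst (suc i ≤_) length-upper (drop≡∷⇒<length i U u-at-i)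

    rest : ∀ h → h ≡ gap (suc i) + gap (suc i) → riseLabels h (ptdPath us ls) ≡ areaWordFrom P (suc i) us ls
    rest h = riseLabels≡areaWordFrom 2≤m+n (suc i) h (drop≡∷⇒drop-suc i U u-at-i) (drop≡∷⇒drop-suc i L l-at-i)

    upper-rise : drop i U ≡ N ∷ us → rowLabel (g + g) ≡ bar (upperLabel P i)
    upper-rise N-at-i = trans (rowLabel-double g) (cong bar (sym (upperLabel≡gap {i} N-at-i)))

    step : ∀ u l → drop i U ≡ u ∷ us → drop i L ≡ l ∷ ls →
           riseLabels (g + g) (ptdPath (u ∷ us) (l ∷ ls)) ≡ areaWordFrom P i (u ∷ us) (l ∷ ls)
    step N E u-at-i l-at-i = cong₂ _∷_ (upper-rise u-at-i) (cong₂ _∷_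
        (trans (rowLabel-double+1 g) (cong unbar (sym (trans (lowerLabel≡gap i<m+n) gap-grows))))
        (rest (suc (suc (g + g))) (trans (cong suc (sym (+-suc g g))) (cong (λ d → d + d) (sym gap-grows)))))
      where
      gap-grows : gap (suc i) ≡ suc g
      gap-grows = trans (gap-suc u-at-i l-at-i) (trans (cong (_∸ (yL + 0)) (+-comm yU 1))
        (trans (cong (suc yU ∸_) (+-identityʳ yL)) (+-∸-assoc 1 (weakly-above P i))))
    step N N u-at-i l-at-i = cong₂ _∷_ (upper-rise u-at-i) (rest (g + g) (cong (λ d → d + d) (sym gap-same)))
      where
      gap-same : gap (suc i) ≡ g
      gap-same = trans (gap-suc u-at-i l-at-i) (trans (cong₂ _∸_ (+-comm yU 1) (+-comm yL 1)) ([m+n]∸[m+o]≡n∸o 1 yU yL))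
    step E N u-at-i l-at-i = rest (g + g ∸ 1 ∸ 1) (trans ([m+m]∸1∸1≡[m∸1]+[m∸1] g) (cong (λ d → d + d) (sym gap-shrinks)))
      where
      gap-shrinks : gap (suc i) ≡ g ∸ 1
      gap-shrinks = trans (gap-suc u-at-i l-at-i) (trans (cong (_∸ (yL + 1)) (+-identityʳ yU)) (sym (∸-+-assoc yU yL 1)))
    step E E u-at-i l-at-i = cong₂ _∷_
        (trans (rowLabel-double∸1 0<g) (cong unbar (sym (trans (lowerLabel≡gap i<m+n) gap-same))))
        (rest (suc (g + g ∸ 1)) (trans (suc[m+m∸1]≡m+m 0<g) (cong (λ d → d + d) (sym gap-same))))
      where
      gap-same : gap (suc i) ≡ g
      gap-same = trans (gap-suc u-at-i l-at-i) (cong₂ _∸_ (+-identityʳ yU) (+-identityʳ yL))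
      0<g : 0 < g
      0<g = gap-constant⇒positive 2≤m+n i<m+n gap-same

proposition3p1 : (m n : ℕ) → 1 ≤ m → 1 ≤ n → (P : Polyo m n) →
    riseLabels 0 (ptd P) ≡ areaWord P
proposition3p1 m n 1≤m 1≤n P = riseLabels≡areaWordFrom P (+-mono-≤ 1≤m 1≤n) 0 0 refl refl refl
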